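{- Let $D_S=(N_S,A_S\cup H_S)$ be a partially time-expanded network, with holdover storage capacities $b'$, satisfying properties (P1)–(P4) and $(P^{\mathtt{storage}})$, and let $\bar x$ be a feasible solution of $\mathrm{UPR}(D_T)$. Then $\hat x=\mu(\bar x)$ satisfies $\sum_{k\in\mathcal{K}_v}\hat x^k_e\le b'_e$ for every holdover arc $e\in H_S$ at any node $v\in N$.
   Context: Base network: a directed graph $D=(N,A)$; each arc $vw\in A$ has a transit time $\tau_{vw}\in\mathbb{N}$ and a capacity $u_{vw}\in\mathbb{N}$; each node $v\in N$ has a storage capacity $b_v\in\mathbb{N}$. $\mathcal{K}$ is a finite set of packets; packet $k$ has origin $s_k$ and destination $t_k$. For $v\in N$ let $\mathcal{K}_v=\{k\in\mathcal{K}: s_k\ne v,\ t_k\ne v\}$. Fix $T\in\mathbb{N}$, $[T]=\{0,\dots,T\}$. Fully time-expanded network $D_T=(N_T,A_T\cup H_T)$: $N_T=\{(v,t):v\in N,t\in[T]\}$; movement arcs $A_T=\{((v,t),(w,t+\tau_{vw})): (v,t)\in N_T, vw\in A, t+\tau_{vw}\le T\}$; holdover arcs $H_T=\{((v,t),(v,t+1)): v\in N, 0\le t<T\}$. $\mathrm{UPR}(D_T)$ is the integer program with binary variables $x^k_e$ ($k\in\mathcal{K}$, $e\in A_T\cup H_T$) and variable $\bar T$: minimize $\bar T$ s.t. $t'x^k_e\le\bar T$ for all $k$, $e=((v,t),(w,t'))\in A_T$; $\sum_{e=((v,t),(w,t'))\in A_T,\,w=t_k}t'x^k_e\le\bar T$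 for all $k$; flow conservation for each $k$ at each $(v,t)\in N_T$ (out minus in equals $1$ at $(s_k,0)$, $-1$ at $(t_k,T)$, $0$ otherwise); $\sum_k x^k_e\le u_{vw}$ for each copy $e\in A_T$ of $vw$; $\sum_{k\in\mathcal{K}_v}x^k_e\le b_v$ for each holdover arc $e$ at $v$. A feasible solution gives each packet $k$ a trajectory $Q_k$ in $D_T$ from $(s_k,0)$ to $(t_k,T)$. Partially time-expanded network: $N_S\subseteq N_T$; $\mathtt{n_S}(v,t)=\min\{t'>t:(v,t')\in N_S\}$, $\mathtt{m_S}(v,t)=\mathtt{n_S}(v,t)-t$ (defined even if $(v,t)\notin N_S$); $H_S$ consists of the arcs $((v,t),(v,\mathtt{n_S}(v,t)))$ for $(v,t)\in N_S$, $t<T$; $A_S$ is a set of arcs $((v,t),(w,t'))$ with both ends in $N_S$ and $vw\in A$. Properties: (P1) $(s_k,0),(t_k,T)\in N_S$ for all $k$; (P2) each $((v,t),(w,t'))\in A_S$ has $t'\le t+\tau_{vw}$; (P3) for each $vw\in A$ and $(v,t)\in N_S$ with $t+\tau_{vw}\le T$, $A_S$ contains a copy of $vw$ starting at $(v,t)$; (P4) if $((v,t),(w,t'))\in A_S$ there is no $(w,t'')\in N_S$ with $t'<t''\le t+\tau_{vw}$. Let $N^-_S(v,t)=\{(w,t'):((w,t'),(v,t))\in A_S\}$, $N^-_T(v,t)=\{(w,t'):((w,t'),(v,t))\in A_T\}$, and for $e=((v,t),(v,t'))\in H_S$ let $U_e=\sum_{(w,t')\in N^-_T(v,t)\cup N^-_S(v,t)}u_{wv}(\mathtt{m_S}(w,t')-1)$.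 Property $(P^{\mathtt{storage}})$: for every $e=((v,t),(v,t'))\in H_S$, $b'_e\ge b_v+U_e$ if $(v,t+1)\in N_S$, and $b'_e\ge 2b_v+U_e$ if $(v,t+1)\notin N_S$. Map $\mu:A_T\to A_S$: $((v,\bar t),(w,\bar t'))\mapsto((v,\hat t),(w,\hat t'))$, $\hat t=\max\{t\le\bar t:(v,t)\in N_S\}$, $\hat t'=\max\{t\le\hat t+\tau_{vw}:(w,t)\in N_S\}$. For feasible $\bar x$, $\hat x=\mu(\bar x)$: for each $k$, $\hat x^k$ is the incidence vector of the trajectory in $D_S$ whose movement arcs are the $\mu$-images of the movement arcs of $Q_k$ in order, joined by holdover arcs of $H_S$ (on movement arcs, $\hat x^k_e=\max\{\bar x^k_f:\mu(f)=e\}$). -}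

module Defs where

open import Data.Nat using (ℕ; zero; suc; _+_; _*_; _∸_; _≤_; _<_; _≡ᵇ_)
open import Data.Fin using (Fin; toℕ)
import Data.Fin as F
open import Data.Bool using (Bool; true; false; if_then_else_; _∧_; _∨_; not)
open import Data.List using (List; []; _∷_; _++_; map; length; filterᵇ; applyUpTo)
open import Data.Bool.ListAction using (any)
open import Data.Product using (_×_; _,_; ∃-syntax)
open import Data.Empty using (⊥)
open import Relation.Binary.PropositionalEquality using (_≡_)

sumFin : (m : ℕ) → (Fin m → ℕ) → ℕ
sumFin zero    f = 0
sumFin (suc m) f = f F.zero + sumFin m (λ i → f (F.suc i))

sumTo : ℕ → (ℕ → ℕ) → ℕ
sumTo zero    f = f 0
sumTo (suc T) f = sumTo T f + f (suc T)

_=ᶠ_ : ∀ {m} → Fin m → Fin m → Bool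
v =ᶠ w = toℕ v ≡ᵇ toℕ w

count : ∀ {A : Set} → (A → Bool) → List A → ℕ
count p xs = length (filterᵇ p xs)

-- Base network D = (N, A) with N = Fin n; A given by the Boolean
-- relation arc (vw ∈ A iff arc v w ≡ true); transit times τ, capacities
-- u, storage capacities b; packets Fin K with origins src, destinations
-- dst; time horizon T.

record Base : Set where
  field
    n   : ℕ
    arc : Fin n → Fin n → Bool
    τ   : Fin n → Fin n → ℕ
    u   : Fin n → Fin n → ℕ
    b   : Fin n → ℕ
    K   : ℕ
    src : Fin K → Fin n
    dst : Fin K → Fin n
    T   : ℕ

module Net (B : Base) where
  open Base B

  inK : Fin n → Fin K → Bool
  inK v k = not (src k =ᶠ v) ∧ not (dst k =ᶠ v)

  sumKv : Fin n → (Fin K → ℕ) → ℕ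
  sumKv v f = sumFin K (λ k → if inK v k then f k else 0)

  -- Fully time-expanded network D_T.
  -- move v w t  : the arc ((v,t),(w,t+τ_vw)) ∈ A_T
  -- hold v t    : the arc ((v,t),(v,t+1)) ∈ H_T
  data TArc : Set where
    move : Fin n → Fin n → ℕ → TArc
    hold : Fin n → ℕ → TArc

  eqTArc : TArc → TArc → Bool
  eqTArc (move v w t) (move v' w' t') = (v =ᶠ v') ∧ (w =ᶠ w') ∧ (t ≡ᵇ t')
  eqTArc (hold v t)   (hold v' t')    = (v =ᶠ v') ∧ (t ≡ᵇ t')
  eqTArc _            _               = false

  data Walk : Fin n × ℕ → List TArc → Fin n × ℕ → Set where
    done  : ∀ {p} → Walk p [] p
    hold∷ : ∀ {v t as q} → t < T →
            Walk (v , suc t) as q → Walk (v , t) (hold v t ∷ as) q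
    move∷ : ∀ {v w t as q} → arc v w ≡ true → t + τ v w ≤ T →
            Walk (w , t + τ v w) as q → Walk (v , t) (move v w t ∷ as) q

  xbar : (Fin K → List TArc) → Fin K → TArc → ℕ
  xbar Q k e = count (eqTArc e) (Q k)

  -- Feasible solution of UPR(D_T), given through its trajectories Q_k
  -- (x̄^k = incidence vector of Q_k).  The T̄-constraints are always
  -- satisfiable (take T̄ = T) and are therefore omitted.
  record UPRFeasible (Q : Fin K → List TArc) : Set where
    field
      trajectory : ∀ k → Walk (src k , 0) (Q k) (dst k , T)
      binary     : ∀ k e → xbar Q k e ≤ 1
      capacity   : ∀ v w t → arc v w ≡ true → t + τ v w ≤ T →
                   sumFin K (λ k → xbar Q k (move v w t)) ≤ u v w
      storage    : ∀ v t → t < T →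
                   sumKv v (λ k → xbar Q k (hold v t)) ≤ b v

  -- Partially time-expanded network D_S, given by
  --   NS v t ≡ true  iff (v,t) ∈ N_S,
  --   AS v t w t' ≡ true  iff ((v,t),(w,t')) ∈ A_S.
  module PTE (NS : Fin n → ℕ → Bool) (AS : Fin n → ℕ → Fin n → ℕ → Bool) where

    -- n_S(v,t) = min{t' > t : (v,t') ∈ N_S}; if there is no such t'
    -- (empty minimum) we return T+1.
    nS : Fin n → ℕ → ℕ
    nS v t = go (suc t) (T ∸ t)
      where
      go : ℕ → ℕ → ℕ
      go c zero    = suc T
      go c (suc f) = if NS v c then c else go (suc c) f

    mS : Fin n → ℕ → ℕ
    mS v t = nS v t ∸ t

    IsHS : Fin n → ℕ → Set
    IsHS v t = NS v t ≡ true × t < T × nS v t ≤ T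

    -- max{t ≤ t̄ : (v,t) ∈ N_S}  (0 if none; (v,0) ∈ N_S is assumed)
    prevS : Fin n → ℕ → ℕ
    prevS v zero    = 0
    prevS v (suc t) = if NS v (suc t) then suc t else prevS v t

    U : Fin n → ℕ → ℕ
    U v t = sumFin n (λ w → sumTo T (λ t' →
              if arc w v ∧ ((t' + τ w v ≡ᵇ t) ∨ AS w t' v t)
              then u w v * (mS w t' ∸ 1) else 0))

    record Props : Set where
      field
        NS-bounded : ∀ v t → NS v t ≡ true → t ≤ T
        NS-zero    : ∀ v → NS v 0 ≡ true
        AS-wf      : ∀ v t w t' → AS v t w t' ≡ true →
                     NS v t ≡ true × NS w t' ≡ true × arc v w ≡ true
        P1         : ∀ k → NS (src k) 0 ≡ true × NS (dst k) T ≡ true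
        P2         : ∀ v t w t' → AS v t w t' ≡ true → t' ≤ t + τ v w
        P3         : ∀ v w t → arc v w ≡ true → NS v t ≡ true →
                     t + τ v w ≤ T → ∃[ t' ] AS v t w t' ≡ true
        P4         : ∀ v t w t' → AS v t w t' ≡ true →
                     ∀ t'' → NS w t'' ≡ true → t' < t'' →
                     t'' ≤ t + τ v w → ⊥

    -- Property (P^storage) for holdover capacities b' (b' v t is the
    -- capacity of the holdover arc of H_S leaving (v,t)).
    PStorage : (Fin n → ℕ → ℕ) → Set
    PStorage b' = ∀ v t → IsHS v t →
      (if NS v (suc t) then b v + U v t else 2 * b v + U v t) ≤ b' v t

    -- Arcs of D_S:  smove v t w t' = ((v,t),(w,t')) ∈ A_S,
    --               shold v t      = ((v,t),(v,n_S(v,t))) ∈ H_S.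
    data SArc : Set where
      smove : Fin n → ℕ → Fin n → ℕ → SArc
      shold : Fin n → ℕ → SArc

    μ : Fin n → Fin n → ℕ → SArc
    μ v w t̄ = smove v (prevS v t̄) w (prevS w (prevS v t̄ + τ v w))

    holds : Fin n → ℕ → ℕ → List SArc
    holds v a c = map (shold v) (filterᵇ (NS v) (applyUpTo (a +_) (c ∸ a)))

    -- trajectory in D_S: the μ-images of the movement arcs of Q_k in
    -- order, joined by holdover arcs; current position (v, c).
    build : Fin n → ℕ → List TArc → List SArc
    build v c []                  = holds v c T
    build v c (hold _ _ ∷ as)     = build v c as
    build v c (move a w t̄ ∷ as)  =
      holds a c (prevS a t̄) ++
      (μ a w t̄ ∷ build w (prevS w (prevS a t̄ + τ a w)) as)

    trajS : (Fin K → List TArc) → Fin K → List SArc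
    trajS Q k = build (src k) 0 (Q k)

    eqHold : Fin n → ℕ → SArc → Bool
    eqHold v t (shold v' t') = (v =ᶠ v') ∧ (t ≡ᵇ t')
    eqHold v t (smove _ _ _ _) = false

    xhatHold : (Fin K → List TArc) → Fin K → Fin n → ℕ → ℕ
    xhatHold Q k v t = if any (eqHold v t) (trajS Q k) then 1 else 0

-- Let e = ((v,t),(v,n_S(v,t))) and let k ∈ 𝒦_v be a packet whose image trajectory uses e.  The
-- image then waits at v from some time c ≤ t on, while in D_T the packet leaves v only at a time
-- ≥ n_S(v,t).  Either the packet was already at v at time t, so Q_k holds over ((v,t),(v,t+1)),
-- or it arrived later by an arc wv departing at some x.  In the second case, by the choice of μ
-- and (P2)–(P4), either t' < x < n_S(w,t') for some (w,t') ∈ N⁻_T(v,t) ∪ N⁻_S(v,t), or the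
-- arrival lies strictly inside (t, n_S(v,t)), so that (v,t+1) ∉ N_S and Q_k holds over
-- ((v,n_S(v,t)−1),(v,n_S(v,t))).  Summing over k, the holdover arcs contribute at most b_v each
-- and the movement arcs at most Σ u_wv (m_S(w,t') − 1) = U_e.

module Submission where

open import Defs
open import Data.Nat using (ℕ; _≤_)
open import Data.Bool using (Bool)
open import Data.Fin using (Fin)
open import Data.List using (List)

open import Algebra.Properties.CommutativeSemigroup using (interchange)
open import Data.Bool using (T?; true; false; if_then_else_; _∧_; _∨_; not)
open import Data.Bool.ListAction using (any)
open import Data.Bool.Properties using (T-≡; ∨-zeroʳ)
import Data.Fin as F
open import Data.Fin using (toℕ)
open import Data.Fin.Properties using (toℕ-injective)
open import Data.List using (length; filterᵇ; applyUpTo)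
open import Data.List.Membership.Propositional using (_∈_; _∉_)
open import Data.List.Membership.Propositional.Properties
  using (∈-filter⁺; ∈-filter⁻; ∈-map⁻; ∈-applyUpTo⁻; ∈-++⁻; ∈-length)
open import Data.List.Properties using (filter-none)
import Data.List.Relation.Unary.All as All
import Data.List.Relation.Unary.Any as Any
open import Data.List.Relation.Unary.Any using (here; there)
open import Data.List.Relation.Unary.Any.Properties using (any⁻)
open import Data.Nat using (zero; suc; _+_; _*_; _∸_; _<_; _≡ᵇ_; z≤n; s≤s; z<s; _≤?_; _<?_)
open import Data.Nat.Properties
open import Data.Empty using (⊥-elim)
open import Data.Product using (_×_; _,_; proj₁; proj₂)
open import Data.Sum using (_⊎_; inj₁; inj₂)
open import Function using (Equivalence; _∘_; id)
open import Relation.Binary.PropositionalEquality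
open import Relation.Nullary using (yes; no)

false≢true : false ≢ true
false≢true ()

∧-true : ∀ {a b} → a ∧ b ≡ true → a ≡ true × b ≡ true
∧-true {true} b≡true = refl , b≡true

≡ᵇ-sound : ∀ {m n} → (m ≡ᵇ n) ≡ true → m ≡ n
≡ᵇ-sound {m} {n} h = ≡ᵇ⇒≡ m n (Equivalence.from T-≡ h)

≡ᵇ-refl : ∀ m → (m ≡ᵇ m) ≡ true
≡ᵇ-refl m = Equivalence.to T-≡ (≡⇒≡ᵇ m m refl)

=ᶠ-sound : ∀ {m} {i j : Fin m} → (i =ᶠ j) ≡ true → i ≡ j
=ᶠ-sound h = toℕ-injective (≡ᵇ-sound h)

n<m⇒m∸n≡1+[m∸1+n] : ∀ {m n} → n < m → m ∸ n ≡ suc (m ∸ suc n)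
n<m⇒m∸n≡1+[m∸1+n] {suc m} {zero}  _         = refl
n<m⇒m∸n≡1+[m∸1+n] {suc m} {suc n} (s≤s n<m) = n<m⇒m∸n≡1+[m∸1+n] n<m

m<o∸n⇒n+m<o : ∀ {m n o} → m < o ∸ n → n + m < o
m<o∸n⇒n+m<o {m} {n} {o} m<o∸n =
  ≤-trans (≤-reflexive (cong suc (+-comm n m)))
          (m≤o∸n⇒m+n≤o (suc m) n≤o m<o∸n)
  where
  n≤o : n ≤ o
  n≤o = <⇒≤ (m∸n≢0⇒n<m λ o∸n≡0 → n≮0 (subst (m <_) o∸n≡0 m<o∸n))

loads≤budget : ∀ β {x y z c d} → x ≤ c → y ≤ (if β then 0 else c) → z ≤ d →
               x + y + z ≤ (if β then c + d else 2 * c + d)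
loads≤budget true  {x} {y} {c = c} x≤c y≤0 z≤d =
  +-mono-≤ (subst (x + y ≤_) (+-identityʳ c) (+-mono-≤ x≤c y≤0)) z≤d
loads≤budget false {x} {y} {c = c} x≤c y≤c z≤d =
  +-mono-≤ (subst (x + y ≤_) (cong (c +_) (sym (+-identityʳ c))) (+-mono-≤ x≤c y≤c)) z≤d

sumFin-cong : ∀ m {f g : Fin m → ℕ} → (∀ i → f i ≡ g i) → sumFin m f ≡ sumFin m g
sumFin-cong zero    f≡g = refl
sumFin-cong (suc m) f≡g = cong₂ _+_ (f≡g F.zero) (sumFin-cong m (λ i → f≡g (F.suc i)))

sumFin-mono : ∀ m {f g : Fin m → ℕ} → (∀ i → f i ≤ g i) → sumFin m f ≤ sumFin m g
sumFin-mono zero    f≤g = z≤n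
sumFin-mono (suc m) f≤g = +-mono-≤ (f≤g F.zero) (sumFin-mono m (λ i → f≤g (F.suc i)))

sumFin-0 : ∀ m → sumFin m (λ _ → 0) ≡ 0
sumFin-0 zero    = refl
sumFin-0 (suc m) = sumFin-0 m

sumFin-+ : ∀ m (f g : Fin m → ℕ) → sumFin m (λ i → f i + g i) ≡ sumFin m f + sumFin m g
sumFin-+ zero    f g = refl
sumFin-+ (suc m) f g = begin
  f F.zero + g F.zero + sumFin m (λ i → f (F.suc i) + g (F.suc i))
    ≡⟨ cong (f F.zero + g F.zero +_) (sumFin-+ m (λ i → f (F.suc i)) (λ i → g (F.suc i))) ⟩
  f F.zero + g F.zero + (sumFin m (λ i → f (F.suc i)) + sumFin m (λ i → g (F.suc i)))
    ≡⟨ interchange +-commutativeSemigroup (f F.zero) (g F.zero) _ _ ⟩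
  sumFin (suc m) f + sumFin (suc m) g ∎
  where open ≡-Reasoning

term≤sumFin : ∀ m (f : Fin m → ℕ) i → f i ≤ sumFin m f
term≤sumFin (suc m) f F.zero    = m≤m+n _ _
term≤sumFin (suc m) f (F.suc i) = ≤-trans (term≤sumFin m (λ j → f (F.suc j)) i) (m≤n+m _ _)

sumTo-mono : ∀ T {f g : ℕ → ℕ} → (∀ x → f x ≤ g x) → sumTo T f ≤ sumTo T g
sumTo-mono zero    f≤g = f≤g 0
sumTo-mono (suc T) f≤g = +-mono-≤ (sumTo-mono T f≤g) (f≤g (suc T))

sumTo-0 : ∀ T → sumTo T (λ _ → 0) ≡ 0
sumTo-0 zero    = refl
sumTo-0 (suc T) = cong (_+ 0) (sumTo-0 T)

sumTo-+ : ∀ T (f g : ℕ → ℕ) → sumTo T (λ x → f x + g x) ≡ sumTo T f + sumTo T g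
sumTo-+ zero    f g = refl
sumTo-+ (suc T) f g = begin
  sumTo T (λ x → f x + g x) + (f (suc T) + g (suc T))
    ≡⟨ cong (_+ (f (suc T) + g (suc T))) (sumTo-+ T f g) ⟩
  sumTo T f + sumTo T g + (f (suc T) + g (suc T))
    ≡⟨ interchange +-commutativeSemigroup (sumTo T f) (sumTo T g) _ _ ⟩
  sumTo (suc T) f + sumTo (suc T) g ∎
  where open ≡-Reasoning

term≤sumTo : ∀ T (f : ℕ → ℕ) {x} → x ≤ T → f x ≤ sumTo T f
term≤sumTo zero    f z≤n = ≤-refl
term≤sumTo (suc T) f {x} x≤1+T with m≤n⇒m<n∨m≡n x≤1+T
... | inj₁ (s≤s x≤T) = ≤-trans (term≤sumTo T f x≤T) (m≤m+n _ _)
... | inj₂ refl      = m≤n+m _ _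

sumRange : ℕ → ℕ → (ℕ → ℕ) → ℕ
sumRange a zero    f = 0
sumRange a (suc m) f = f a + sumRange (suc a) m f

sumRange-0 : ∀ a m → sumRange a m (λ _ → 0) ≡ 0
sumRange-0 a zero    = refl
sumRange-0 a (suc m) = sumRange-0 (suc a) m

sumRange-+ : ∀ a m (f g : ℕ → ℕ) → sumRange a m (λ x → f x + g x) ≡ sumRange a m f + sumRange a m g
sumRange-+ a zero    f g = refl
sumRange-+ a (suc m) f g = begin
  f a + g a + sumRange (suc a) m (λ x → f x + g x)
    ≡⟨ cong (f a + g a +_) (sumRange-+ (suc a) m f g) ⟩
  f a + g a + (sumRange (suc a) m f + sumRange (suc a) m g)
    ≡⟨ interchange +-commutativeSemigroup (f a) (g a) _ _ ⟩
  sumRange a (suc m) f + sumRange a (suc m) g ∎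
  where open ≡-Reasoning

term≤sumRange : ∀ a m (f : ℕ → ℕ) {x} → a ≤ x → x < a + m → f x ≤ sumRange a m f
term≤sumRange a zero    f a≤x x<a+0 = ⊥-elim (<⇒≱ x<a+0 (≤-trans (≤-reflexive (+-identityʳ a)) a≤x))
term≤sumRange a (suc m) f a≤x x<a+1+m with m≤n⇒m<n∨m≡n a≤x
... | inj₁ a<x = ≤-trans (term≤sumRange (suc a) m f a<x (<-≤-trans x<a+1+m (≤-reflexive (+-suc a m))))
                         (m≤n+m _ _)
... | inj₂ refl = m≤m+n _ _

sumRange≤* : ∀ a m {f : ℕ → ℕ} {c} → (∀ x → f x ≤ c) → sumRange a m f ≤ m * c
sumRange≤* a zero    f≤c = z≤n
sumRange≤* a (suc m) f≤c = +-mono-≤ (f≤c a) (sumRange≤* (suc a) m f≤c)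

sumFin-comm : ∀ {X : Set} (S : (X → ℕ) → ℕ) → S (λ _ → 0) ≡ 0 →
              (∀ f g → S (λ x → f x + g x) ≡ S f + S g) →
              ∀ K (G : X → Fin K → ℕ) →
              sumFin K (λ k → S (λ x → G x k)) ≡ S (λ x → sumFin K (G x))
sumFin-comm S S-0 S-+ zero    G = sym S-0
sumFin-comm S S-0 S-+ (suc K) G = begin
  S (λ x → G x F.zero) + sumFin K (λ k → S (λ x → G x (F.suc k)))
    ≡⟨ cong (S (λ x → G x F.zero) +_) (sumFin-comm S S-0 S-+ K (λ x k → G x (F.suc k))) ⟩
  S (λ x → G x F.zero) + S (λ x → sumFin K (λ k → G x (F.suc k)))
    ≡⟨ sym (S-+ _ _) ⟩
  S (λ x → sumFin (suc K) (G x)) ∎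
  where open ≡-Reasoning

module _ (B : Base) where
  open Base B
  open Net B

  sumKv-mono : ∀ v {f g : Fin K → ℕ} → (∀ k → inK v k ≡ true → f k ≤ g k) → sumKv v f ≤ sumKv v g
  sumKv-mono v f≤g = sumFin-mono K λ k → filtered (inK v k) (f≤g k)
    where
    filtered : ∀ β {x y} → (β ≡ true → x ≤ y) → (if β then x else 0) ≤ (if β then y else 0)
    filtered true  x≤y = x≤y refl
    filtered false _   = z≤n

  sumKv-+ : ∀ v (f g : Fin K → ℕ) → sumKv v (λ k → f k + g k) ≡ sumKv v f + sumKv v g
  sumKv-+ v f g = trans (sumFin-cong K λ k → if-+ (inK v k)) (sumFin-+ K _ _)
    where
    if-+ : ∀ β {x y} → (if β then x + y else 0) ≡ (if β then x else 0) + (if β then y else 0)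
    if-+ true  = refl
    if-+ false = refl

  sumKv≤sumFin : ∀ v (f : Fin K → ℕ) → sumKv v f ≤ sumFin K f
  sumKv≤sumFin v f = sumFin-mono K λ k → if≤ (inK v k)
    where
    if≤ : ∀ β {x} → (if β then x else 0) ≤ x
    if≤ true  = ≤-refl
    if≤ false = z≤n

  inK-sound : ∀ {v k} → inK v k ≡ true → src k ≢ v × dst k ≢ v
  inK-sound {v} {k} k∈Kv with ∧-true {not (src k =ᶠ v)} k∈Kv
  ... | src≢v , dst≢v = distinct src≢v , distinct dst≢v
    where
    distinct : ∀ {i j : Fin n} → not (i =ᶠ j) ≡ true → i ≢ j
    distinct {i} ¬i=j refl rewrite ≡ᵇ-refl (toℕ i) = false≢true ¬i=j

  eqTArc-refl : ∀ e → eqTArc e e ≡ true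
  eqTArc-refl (move v w t) rewrite ≡ᵇ-refl (toℕ v) | ≡ᵇ-refl (toℕ w) | ≡ᵇ-refl t = refl
  eqTArc-refl (hold v t)   rewrite ≡ᵇ-refl (toℕ v) | ≡ᵇ-refl t = refl

  eqTArc-sound : ∀ e f → eqTArc e f ≡ true → e ≡ f
  eqTArc-sound (move v w t) (move v' w' t') h
    with v≡v' , h' ← ∧-true {v =ᶠ v'} h
    with w≡w' , t≡t' ← ∧-true {w =ᶠ w'} h'
    rewrite =ᶠ-sound {i = v} v≡v' | =ᶠ-sound {i = w} w≡w' | ≡ᵇ-sound {t} t≡t' = refl
  eqTArc-sound (hold v t) (hold v' t') h
    with v≡v' , t≡t' ← ∧-true {v =ᶠ v'} h
    rewrite =ᶠ-sound {i = v} v≡v' | ≡ᵇ-sound {t} t≡t' = refl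

  xbar-∈ : ∀ Q k {e} → e ∈ Q k → 1 ≤ xbar Q k e
  xbar-∈ Q k {e} e∈Qk = ∈-length (∈-filter⁺ (T? ∘ eqTArc e) e∈Qk (Equivalence.from T-≡ (eqTArc-refl e)))

  xbar-∉ : ∀ Q k {e} → e ∉ Q k → xbar Q k e ≡ 0
  xbar-∉ Q k {e} e∉Qk = cong length (filter-none (T? ∘ eqTArc e)
    (All.tabulate λ {f} f∈Qk ef → e∉Qk (subst (_∈ Q k) (sym (eqTArc-sound e f (Equivalence.to T-≡ ef))) f∈Qk)))

  move∈walk-fits : ∀ {p as q a w x} → Walk p as q → move a w x ∈ as → x + τ a w ≤ T
  move∈walk-fits (hold∷ _ W)      (there m)   = move∈walk-fits W m
  move∈walk-fits (move∷ _ fits _) (here refl) = fits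
  move∈walk-fits (move∷ _ _ W)    (there m)   = move∈walk-fits W m

  move-load≤u : ∀ {Q} → UPRFeasible Q → ∀ {v w} x → arc w v ≡ true →
                sumFin K (λ k → xbar Q k (move w v x)) ≤ u w v
  move-load≤u {Q} Fe {v} {w} x arcT with x + τ w v ≤? T
  ... | yes fits  = UPRFeasible.capacity Fe w v x arcT fits
  ... | no  x+τ≰T = ≤-trans (≤-reflexive (trans (sumFin-cong K unused) (sumFin-0 K))) z≤n
    where
    unused : ∀ k → xbar Q k (move w v x) ≡ 0
    unused k = xbar-∉ Q k λ m∈Qk → x+τ≰T (move∈walk-fits (UPRFeasible.trajectory Fe k) m∈Qk)

  module _ (NS : Fin n → ℕ → Bool) (AS : Fin n → ℕ → Fin n → ℕ → Bool) where
    open PTE NS AS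

    nS-hit : ∀ {z s} → s < T → NS z (suc s) ≡ true → nS z s ≡ suc s
    nS-hit s<T hit rewrite n<m⇒m∸n≡1+[m∸1+n] s<T | hit = refl

    nS-miss : ∀ {z s} → s < T → NS z (suc s) ≡ false → nS z s ≡ nS z (suc s)
    nS-miss s<T miss rewrite n<m⇒m∸n≡1+[m∸1+n] s<T | miss = refl

    nS-beyond : ∀ {z s} → T ≤ s → nS z s ≡ suc T
    nS-beyond T≤s rewrite m≤n⇒m∸n≡0 T≤s = refl

    nS-least : ∀ {z s x} → s < x → x ≤ T → NS z x ≡ true → nS z s ≤ x
    nS-least {z} {s} {x} s<x x≤T Nx = go T (m≤m+n T s) s<x
      where
      go : ∀ d {s} → T ≤ d + s → s < x → nS z s ≤ x
      go zero        T≤s   s<x = ⊥-elim (<⇒≱ (<-≤-trans s<x x≤T) T≤s)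
      go (suc d) {s} T≤d+s s<x with NS z (suc s) in e | m≤n⇒m<n∨m≡n s<x
      ... | true  | _         = ≤-trans (≤-reflexive (nS-hit (<-≤-trans s<x x≤T) e)) s<x
      ... | false | inj₂ refl = ⊥-elim (false≢true (trans (sym e) Nx))
      ... | false | inj₁ 1+s<x = ≤-trans (≤-reflexive (nS-miss (<-≤-trans s<x x≤T) e))
                                   (go d (subst (T ≤_) (sym (+-suc d s)) T≤d+s) 1+s<x)

    nS≤T⇒<T : ∀ {z s} → nS z s ≤ T → s < T
    nS≤T⇒<T {z} {s} nS≤T with s <? T
    ... | yes s<T = s<T
    ... | no  s≮T = ⊥-elim (1+n≰n (subst (_≤ T) (nS-beyond (≮⇒≥ s≮T)) nS≤T))

    nS-spec : ∀ {z s} → nS z s ≤ T → NS z (nS z s) ≡ true × s < nS z s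
    nS-spec {z} {s} = go T (m≤m+n T s)
      where
      go : ∀ d {s} → T ≤ d + s → nS z s ≤ T → NS z (nS z s) ≡ true × s < nS z s
      go zero        T≤s   nS≤T = ⊥-elim (<⇒≱ (nS≤T⇒<T nS≤T) T≤s)
      go (suc d) {s} T≤d+s nS≤T with NS z (suc s) in e
      ... | true  rewrite nS-hit (nS≤T⇒<T nS≤T) e = e , ≤-refl
      ... | false =
        let s<T = nS≤T⇒<T nS≤T
            skip : nS z s ≡ nS z (suc s)
            skip = nS-miss s<T e
            N , 1+s<nS = go d (subst (T ≤_) (sym (+-suc d s)) T≤d+s) (subst (_≤ T) skip nS≤T)
        in subst (λ m → NS z m ≡ true × s < m) (sym skip) (N , <-trans (n<1+n s) 1+s<nS)

    nS-gap : ∀ {z s x} → s < x → x < nS z s → x ≤ T → NS z x ≡ false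
    nS-gap {z} {s} {x} s<x x<nS x≤T with NS z x in e
    ... | false = refl
    ... | true  = ⊥-elim (<⇒≱ x<nS (nS-least s<x x≤T e))

    prevS-≤ : ∀ z x → prevS z x ≤ x
    prevS-≤ z zero    = z≤n
    prevS-≤ z (suc x) with NS z (suc x)
    ... | true  = ≤-refl
    ... | false = m≤n⇒m≤1+n (prevS-≤ z x)

    prevS-NS : ∀ {z} x → NS z 0 ≡ true → NS z (prevS z x) ≡ true
    prevS-NS     zero    N0 = N0
    prevS-NS {z} (suc x) N0 with NS z (suc x) in e
    ... | true  = e
    ... | false = prevS-NS x N0

    prevS-greatest : ∀ {z x y} → NS z y ≡ true → y ≤ x → y ≤ prevS z x
    prevS-greatest {z} {zero}  Ny y≤0 = y≤0
    prevS-greatest {z} {suc x} Ny y≤1+x with NS z (suc x) in e | m≤n⇒m<n∨m≡n y≤1+x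
    ... | true  | _              = y≤1+x
    ... | false | inj₁ (s≤s y≤x) = prevS-greatest Ny y≤x
    ... | false | inj₂ refl      = ⊥-elim (false≢true (trans (sym e) Ny))

    <nS-of-prevS≤ : ∀ {z s y} → prevS z s ≤ y → s ≤ T → s < nS z y
    <nS-of-prevS≤ {z} {s} {y} prev≤y s≤T with s <? nS z y
    ... | yes s<nS = s<nS
    ... | no  s≮nS =
      let nS≤s = ≮⇒≥ s≮nS
          N , y<nS = nS-spec (≤-trans nS≤s s≤T)
      in ⊥-elim (<⇒≱ y<nS (≤-trans (prevS-greatest N nS≤s) prev≤y))

    shold∈holds : ∀ {a c c' v y} → shold v y ∈ holds a c c' → a ≡ v × c ≤ y × y < c'
    shold∈holds {a} {c} {c'} h with ∈-map⁻ (shold a) {xs = filterᵇ (NS a) (applyUpTo (c +_) (c' ∸ c))} h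
    ... | y , y∈ , refl
      with ∈-applyUpTo⁻ (c +_) (proj₁ (∈-filter⁻ (T? ∘ NS a) {xs = applyUpTo (c +_) (c' ∸ c)} y∈))
    ...   | i , i<c'∸c , refl = refl , m≤m+n c i , m<o∸n⇒n+m<o i<c'∸c

    eqHold-sound : ∀ {v t} e → eqHold v t e ≡ true → shold v t ≡ e
    eqHold-sound {v} {t} (shold v' t') h with v≡v' , t≡t' ← ∧-true {v =ᶠ v'} h
      rewrite =ᶠ-sound {i = v} v≡v' | ≡ᵇ-sound {t} t≡t' = refl

    any-eqHold⇒∈ : ∀ {v t} xs → any (eqHold v t) xs ≡ true → shold v t ∈ xs
    any-eqHold⇒∈ xs used =
      Any.map (eqHold-sound _ ∘ Equivalence.to T-≡) (any⁻ _ xs (Equivalence.from T-≡ used))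

    module _ (P : Props) where
      open Props P

      μ-∈-AS : ∀ {a w t̂} → arc a w ≡ true → NS a t̂ ≡ true → t̂ + τ a w ≤ T →
               AS a t̂ w (prevS w (t̂ + τ a w)) ≡ true
      μ-∈-AS {a} {w} {t̂} arcT Nt̂ fits with P3 a w t̂ arcT Nt̂ fits
      ... | t'' , A with m≤n⇒m<n∨m≡n (prevS-greatest (proj₁ (proj₂ (AS-wf a t̂ w t'' A))) (P2 a t̂ w t'' A))
      ...   | inj₂ refl = A
      ...   | inj₁ t''<prev =
        ⊥-elim (P4 a t̂ w t'' A _ (prevS-NS (t̂ + τ a w) (NS-zero w)) t''<prev (prevS-≤ w _))

      module _ {v t} (hs : IsHS v t) where
        private
          NSt : NS v t ≡ true
          NSt = proj₁ hs
          t<T : t < T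
          t<T = proj₁ (proj₂ hs)
          nS≤T : nS v t ≤ T
          nS≤T = proj₂ (proj₂ hs)

        inNeighbour : Fin n → ℕ → Bool
        inNeighbour w t' = arc w v ∧ ((t' + τ w v ≡ᵇ t) ∨ AS w t' v t)

        -- A packet using the holdover arc (v,t) → (v,nS v t) of D_S is charged to one of
        -- these arcs of its trajectory L in D_T; they correspond to the terms b_v, b_v, U_e.
        data Charge (L : List TArc) : Set where
          hold-at-t   : hold v t ∈ L → Charge L
          hold-at-gap : NS v (suc t) ≡ false → hold v (nS v t ∸ 1) ∈ L → Charge L
          move-into   : ∀ w t' x → t' ≤ T → inNeighbour w t' ≡ true → t' < x → x < nS w t' →
                        move w v x ∈ L → Charge L

        Waiting : ℕ → Set
        Waiting s = s ≤ t ⊎ (s < nS v t × NS v (suc t) ≡ false)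

        -- The packet is at (a , s) in D_T and its image at (a , c) in D_S.
        Invariant : List TArc → Fin n → ℕ → ℕ → Set
        Invariant L a c s = a ≡ v → c ≤ t → Charge L ⊎ Waiting s

        invariant-hold : ∀ {L a c s} → hold a s ∈ L → Invariant L a c s → Invariant L a c (suc s)
        invariant-hold {s = s} h∈L inv refl c≤t with inv refl c≤t
        ... | inj₁ charge = inj₁ charge
        ... | inj₂ (inj₁ s≤t) with m≤n⇒m<n∨m≡n s≤t
        ...   | inj₁ s<t  = inj₂ (inj₁ s<t)
        ...   | inj₂ refl = inj₁ (hold-at-t h∈L)
        invariant-hold {L} h∈L inv refl c≤t | inj₂ (inj₂ (s<nS , gap)) with m≤n⇒m<n∨m≡n s<nS
        ...   | inj₁ 1+s<nS = inj₂ (inj₂ (1+s<nS , gap))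
        ...   | inj₂ 1+s≡nS = inj₁ (hold-at-gap gap (subst (λ r → hold v (r ∸ 1) ∈ L) 1+s≡nS h∈L))

        charge-move-into : ∀ {L a s t'} → move a v s ∈ L → inNeighbour a t' ≡ true →
                           t' < s → prevS a s ≤ t' → s + τ a v ≤ T → Charge L
        charge-move-into {a = a} {s} {t'} m∈L inN t'<s prev≤t' fits =
          move-into a t' s (≤-trans (<⇒≤ t'<s) s≤T) inN t'<s (<nS-of-prevS≤ prev≤t' s≤T) m∈L
          where
          s≤T : s ≤ T
          s≤T = ≤-trans (m≤m+n s (τ a v)) fits

        inNeighbour-T : ∀ {w t'} → arc w v ≡ true → t' + τ w v ≡ t → inNeighbour w t' ≡ true
        inNeighbour-T arcT refl rewrite arcT | ≡ᵇ-refl t = refl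

        inNeighbour-S : ∀ {w t'} → arc w v ≡ true → AS w t' v t ≡ true → inNeighbour w t' ≡ true
        inNeighbour-S {w} {t'} arcT A rewrite arcT | A | ∨-zeroʳ (t' + τ w v ≡ᵇ t) = refl

        invariant-move : ∀ {L a w s} → move a w s ∈ L → arc a w ≡ true → s + τ a w ≤ T →
                         Invariant L w (prevS w (prevS a s + τ a w)) (s + τ a w)
        invariant-move {a = a} {s = s} m∈L arcT fits refl c≤t
          with s + τ a v ≤? t | prevS a s + τ a v ≤? t | m≤n⇒m<n∨m≡n (prevS-≤ a s)
        ... | yes r≤t | _ | _ = inj₂ (inj₁ r≤t)
        ... | no r≰t | yes t̂+τ≤t | _ =
          inj₁ (charge-move-into m∈L (inNeighbour-T arcT (m∸n+n≡m τ≤t)) t'<s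
                                 (m+n≤o⇒m≤o∸n _ t̂+τ≤t) fits)
          where
          τ≤t : τ a v ≤ t
          τ≤t = ≤-trans (m≤n+m (τ a v) (prevS a s)) t̂+τ≤t
          t'<s : t ∸ τ a v < s
          t'<s = +-cancelʳ-< (τ a v) (t ∸ τ a v) s
                   (subst (_< s + τ a v) (sym (m∸n+n≡m τ≤t)) (≰⇒> r≰t))
        -- Otherwise the μ-image of the arc ends at (v , t), so (a , prevS a s) ∈ N⁻_S(v,t).
        ... | no _ | no t̂+τ≰t | inj₁ t̂<s =
          inj₁ (charge-move-into m∈L (inNeighbour-S arcT lands-at-t) t̂<s ≤-refl fits)
          where
          lands-at-t : AS a (prevS a s) v t ≡ true
          lands-at-t = subst (λ c → AS a (prevS a s) v c ≡ true)
            (≤-antisym c≤t (prevS-greatest NSt (<⇒≤ (≰⇒> t̂+τ≰t))))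
            (μ-∈-AS arcT (prevS-NS s (NS-zero a)) (≤-trans (+-monoˡ-≤ (τ a v) (prevS-≤ a s)) fits))
        ... | no _ | no t̂+τ≰t | inj₂ t̂≡s =
          inj₂ (inj₂ (r<nS , nS-gap ≤-refl (≤-<-trans t<r r<nS) t<T))
          where
          t<r : t < s + τ a v
          t<r = subst (λ t̂ → t < t̂ + τ a v) t̂≡s (≰⇒> t̂+τ≰t)
          r<nS : s + τ a v < nS v t
          r<nS = <nS-of-prevS≤ (subst (λ t̂ → prevS v (t̂ + τ a v) ≤ t) t̂≡s c≤t) fits

        charge-on-departure : ∀ {L a c s} → s ≤ T → Invariant L a c s →
                              shold v t ∈ holds a c (prevS a s) → Charge L
        charge-on-departure {s = s} s≤T inv h with shold∈holds h
        ... | refl , c≤t , t<prev with inv refl c≤t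
        ...   | inj₁ charge             = charge
        ...   | inj₂ (inj₁ s≤t)         = ⊥-elim (<⇒≱ (<-≤-trans t<prev (prevS-≤ v s)) s≤t)
        ...   | inj₂ (inj₂ (s<nS , _)) = ⊥-elim (<⇒≱ s<nS (≤-trans nS≤prev (prevS-≤ v s)))
          where
          nS≤prev : nS v t ≤ prevS v s
          nS≤prev = nS-least t<prev (≤-trans (prevS-≤ v s) s≤T) (prevS-NS s (NS-zero v))

        charge-of-walk : ∀ {L a s as d e c} → Walk (a , s) as (d , e) → d ≢ v →
                         (∀ {x} → x ∈ as → x ∈ L) → Invariant L a c s →
                         shold v t ∈ build a c as → Charge L
        charge-of-walk {c = c} done d≢v _ _ h = ⊥-elim (d≢v (proj₁ (shold∈holds {c = c} {c' = T} h)))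
        charge-of-walk (hold∷ _ W) d≢v as⊆L inv h =
          charge-of-walk W d≢v (as⊆L ∘ there) (invariant-hold (as⊆L (here refl)) inv) h
        charge-of-walk {a = a} {s} {c = c} (move∷ arcT fits W) d≢v as⊆L inv h
          with ∈-++⁻ (holds a c (prevS a s)) h
        ... | inj₁ h₁          = charge-on-departure (≤-trans (m≤m+n s _) fits) inv h₁
        ... | inj₂ (there h₂) =
          charge-of-walk W d≢v (as⊆L ∘ there) (invariant-move (as⊆L (here refl)) arcT fits) h₂

        module _ {Q : Fin K → List TArc} (Fe : UPRFeasible Q) where
          open UPRFeasible Fe

          charge-of-use : ∀ k → inK v k ≡ true → any (eqHold v t) (trajS Q k) ≡ true → Charge (Q k)
          charge-of-use k k∈Kv used with inK-sound k∈Kv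
          ... | src≢v , dst≢v =
            charge-of-walk (trajectory k) dst≢v id (⊥-elim ∘ src≢v) (any-eqHold⇒∈ _ used)

          inflowFrom : Fin n → ℕ → Fin K → ℕ
          inflowFrom w t' k = sumRange (suc t') (nS w t' ∸ suc t') (λ x → xbar Q k (move w v x))

          holdLoad gapLoad inflow : Fin K → ℕ
          holdLoad k = xbar Q k (hold v t)
          gapLoad  k = if NS v (suc t) then 0 else xbar Q k (hold v (nS v t ∸ 1))
          inflow   k = sumFin n λ w → sumTo T λ t' → if inNeighbour w t' then inflowFrom w t' k else 0

          charge≤load : ∀ {k} → Charge (Q k) → 1 ≤ holdLoad k + gapLoad k + inflow k
          charge≤load {k} (hold-at-t h∈Q) =
            ≤-trans (xbar-∈ Q k h∈Q) (≤-trans (m≤m+n _ (gapLoad k)) (m≤m+n _ (inflow k)))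
          charge≤load {k} (hold-at-gap gap h∈Q) =
            ≤-trans (subst (λ β → 1 ≤ (if β then 0 else xbar Q k (hold v (nS v t ∸ 1)))) (sym gap)
                           (xbar-∈ Q k h∈Q))
                    (≤-trans (m≤n+m (gapLoad k) (holdLoad k)) (m≤m+n _ (inflow k)))
          charge≤load {k} (move-into w t' x t'≤T inN t'<x x<nS m∈Q) = begin
            1                                  ≤⟨ xbar-∈ Q k m∈Q ⟩
            xbar Q k (move w v x)              ≤⟨ term≤sumRange (suc t') _ _ t'<x x<end ⟩
            inflowFrom w t' k                  ≡⟨ cong (λ β → if β then inflowFrom w t' k else 0) (sym inN) ⟩
            via w t'                           ≤⟨ term≤sumTo T (via w) t'≤T ⟩
            sumTo T (via w)                    ≤⟨ term≤sumFin n (λ w' → sumTo T (via w')) w ⟩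
            inflow k                           ≤⟨ m≤n+m _ _ ⟩
            holdLoad k + gapLoad k + inflow k  ∎
            where
            open ≤-Reasoning
            via : Fin n → ℕ → ℕ
            via w' t'' = if inNeighbour w' t'' then inflowFrom w' t'' k else 0
            x<end : x < suc t' + (nS w t' ∸ suc t')
            x<end = subst (x <_) (sym (m+[n∸m]≡n (<-trans t'<x x<nS))) x<nS

          xhatHold≤load : ∀ k → inK v k ≡ true → xhatHold Q k v t ≤ holdLoad k + gapLoad k + inflow k
          xhatHold≤load k k∈Kv with any (eqHold v t) (trajS Q k) in used
          ... | false = z≤n
          ... | true  = charge≤load (charge-of-use k k∈Kv used)

          sumKv-gapLoad≤ : sumKv v (λ k → if NS v (suc t) then 0 else xbar Q k (hold v (nS v t ∸ 1)))
                           ≤ (if NS v (suc t) then 0 else b v)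
          sumKv-gapLoad≤ with NS v (suc t)
          ... | true  = ≤-trans (sumKv≤sumFin v _) (≤-reflexive (sumFin-0 K))
          ... | false = storage v (nS v t ∸ 1) (<-≤-trans (∸-monoʳ-< z<s 1≤nS) nS≤T)
            where
            1≤nS : 1 ≤ nS v t
            1≤nS = ≤-trans (s≤s z≤n) (proj₂ (nS-spec {v} {t} nS≤T))

          sumFin-inflowFrom≤ : ∀ w t' → sumFin K (λ k → if inNeighbour w t' then inflowFrom w t' k else 0)
                                        ≤ (if inNeighbour w t' then u w v * (mS w t' ∸ 1) else 0)
          sumFin-inflowFrom≤ w t' with inNeighbour w t' in inN
          ... | false = ≤-reflexive (sumFin-0 K)
          ... | true  = begin
            sumFin K (inflowFrom w t')
              ≡⟨ sumFin-comm (sumRange (suc t') len) (sumRange-0 (suc t') len) (sumRange-+ (suc t') len) K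
                             (λ x k → xbar Q k (move w v x)) ⟩
            sumRange (suc t') len (λ x → sumFin K λ k → xbar Q k (move w v x))
              ≤⟨ sumRange≤* (suc t') len (λ x → move-load≤u Fe x (proj₁ (∧-true inN))) ⟩
            len * u w v
              ≡⟨ *-comm len (u w v) ⟩
            u w v * len
              ≡⟨ cong (u w v *_) (trans (cong (nS w t' ∸_) (+-comm 1 t')) (sym (∸-+-assoc (nS w t') t' 1))) ⟩
            u w v * (mS w t' ∸ 1) ∎
            where
            open ≤-Reasoning
            len : ℕ
            len = nS w t' ∸ suc t'

          sumKv-inflow≤U : sumKv v inflow ≤ U v t
          sumKv-inflow≤U = begin
            sumKv v inflow
              ≤⟨ sumKv≤sumFin v inflow ⟩
            sumFin K inflow
              ≡⟨ sumFin-comm (sumFin n) (sumFin-0 n) (sumFin-+ n) K _ ⟩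
            sumFin n (λ w → sumFin K λ k → sumTo T λ t' → if inNeighbour w t' then inflowFrom w t' k else 0)
              ≡⟨ sumFin-cong n (λ w → sumFin-comm (sumTo T) (sumTo-0 T) (sumTo-+ T) K _) ⟩
            sumFin n (λ w → sumTo T λ t' → sumFin K λ k → if inNeighbour w t' then inflowFrom w t' k else 0)
              ≤⟨ sumFin-mono n (λ w → sumTo-mono T (sumFin-inflowFrom≤ w)) ⟩
            U v t ∎
            where open ≤-Reasoning

          sumKv-xhatHold≤budget : sumKv v (λ k → xhatHold Q k v t) ≤
                                  (if NS v (suc t) then b v + U v t else 2 * b v + U v t)
          sumKv-xhatHold≤budget = begin
            sumKv v (λ k → xhatHold Q k v t)
              ≤⟨ sumKv-mono v xhatHold≤load ⟩
            sumKv v (λ k → holdLoad k + gapLoad k + inflow k)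
              ≡⟨ trans (sumKv-+ v _ inflow) (cong (_+ sumKv v inflow) (sumKv-+ v holdLoad gapLoad)) ⟩
            sumKv v holdLoad + sumKv v gapLoad + sumKv v inflow
              ≤⟨ loads≤budget (NS v (suc t)) (storage v t t<T) sumKv-gapLoad≤ sumKv-inflow≤U ⟩
            (if NS v (suc t) then b v + U v t else 2 * b v + U v t) ∎
            where open ≤-Reasoning

lemma7 : (B : Base) →
    (NS : Fin (Base.n B) → ℕ → Bool) →
    (AS : Fin (Base.n B) → ℕ → Fin (Base.n B) → ℕ → Bool) →
    (b' : Fin (Base.n B) → ℕ → ℕ) →
    Net.PTE.Props B NS AS → Net.PTE.PStorage B NS AS b' →
    (Q : Fin (Base.K B) → List (Net.TArc B)) → Net.UPRFeasible B Q →
    ∀ v t → Net.PTE.IsHS B NS AS v t →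
    Net.sumKv B v (λ k → Net.PTE.xhatHold B NS AS Q k v t) ≤ b' v t
lemma7 B NS AS b' P storage′ Q Fe v t hs =
  ≤-trans (sumKv-xhatHold≤budget B NS AS P hs Fe) (storage′ v t hs)
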